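{- Let $F, G$ be sets of ground clauses and let $C$ be a provenance-labeled clause of a provenance-labeled ground resolution proof for $F, G$. Then (i) $F \models \mathrm{ripol}(C) \lor C|_{\mathsf F}$ and $G \models \lnot\mathrm{ripol}(C) \lor C|_{\mathsf G}$; (ii) $\mathrm{Lit}(\mathrm{ripol}(C)) \subseteq \mathrm{Lit}(F) \cap \overline{\mathrm{Lit}}(G)$.
   Context: Ground resolution calculus: from $C\lor L$ and $D\lor\bar L$ derive $C\lor D$ (resolvent upon $L$); from $C\lor L\lor L$ derive $C\lor L$ (merge). Clauses are multisets of literals; $\bar L$ is the complement of $L$. A ground resolution proof for $F \cup G$ is a sequence of clauses ending in the empty clause, each an input clause from $F\cup G$ or derived by these rules from earlier ones. A provenance-labeled clause associates with each literal occurrence a nonempty label $\mathcal A\subseteq\{\mathsf F,\mathsf G\}$, written $L^{\mathcal A}$. In a provenance-labeled ground resolution proof for $F,G$, literals of input clauses from $F$ get label $\{\mathsf F\}$, those from $G$ get $\{\mathsf G\}$; a resolvent $C\lor D$ inherits the labels of $C, D$ from the premises; in a merge $C\lor L$ the label of $L$ is the union of the labels of the two merged occurrences and $C$ keeps its labels. For $\mathcal X\in\{\mathsf F,\mathsf G\}$ and $C=\bigvee_i L_i^{\mathcal A_i}$, $C|_{\mathcal X} = \bigvee_{\mathcal X\in\mathcal A_i} L_i$. $\mathrm{ripol}$ is defined inductively: for an input clause from $F$: $\bot$; from $G$: $\top$; for a merge from premise $D$: $\mathrm{ripol}(D)$. For a resolvent $C\lor D$ of $C\lor L^{\mathcal A}$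 and $D\lor \bar L^{\mathcal B}$ with $H_1=\mathrm{ripol}(C\lor L^{\mathcal A})$, $H_2=\mathrm{ripol}(D\lor\bar L^{\mathcal B})$: if $(\mathcal A,\mathcal B)=(\{\mathsf F\},\{\mathsf F\})$: $H_1\lor H_2$; $(\{\mathsf F\},\{\mathsf G\})$: $H_1\lor(L\land H_2)$ or alternatively $(L\lor H_1)\land H_2$; $(\{\mathsf F\},\{\mathsf F,\mathsf G\})$: $H_1\lor(L\land H_2)$; $(\{\mathsf G\},\{\mathsf G\})$: $H_1\land H_2$; $(\{\mathsf G\},\{\mathsf F,\mathsf G\})$: $H_1\land(\bar L\lor H_2)$; $(\{\mathsf F,\mathsf G\},\{\mathsf F,\mathsf G\})$: $(\bar L\land H_1)\lor(L\land H_2)$ or alternatively $(L\lor H_1)\land(\bar L\lor H_2)$ (the lemma holds for either choice in each alternative case). $\mathrm{Lit}(X)$ is the set of literals occurring in $X$, $\overline{\mathrm{Lit}}(X)$ the set of their complements. -}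

module Defs where

open import Data.Nat using (ℕ)
open import Data.Bool using (Bool; true; false; not; _∧_; _∨_)
open import Data.List using (List; []; _∷_; _++_; map)
open import Data.List.Membership.Propositional using (_∈_)
open import Data.List.Relation.Unary.Any using (Any)
open import Data.List.Relation.Binary.Permutation.Propositional using (_↭_)
open import Data.Product using (_×_; _,_; Σ; ∃)
open import Data.Sum using (_⊎_)
open import Relation.Binary.PropositionalEquality using (_≡_)

record Literal : Set where
  constructor mkLit
  field
    atom     : ℕ
    positive : Bool
open Literal public

comp : Literal → Literal
comp (mkLit a s) = mkLit a (not s)

-- a clause is a multiset of literals, represented by a list
-- (order is irrelevant: the rules below work up to permutation _↭_)
Clause : Set
Clause = List Literal

ClauseSet : Set₁
ClauseSet = Clause → Set

Assignment : Set
Assignment = ℕ → Bool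

evalLit : Assignment → Literal → Bool
evalLit σ (mkLit a true)  = σ a
evalLit σ (mkLit a false) = not (σ a)

SatClause : Assignment → Clause → Set
SatClause σ c = Any (λ l → evalLit σ l ≡ true) c

SatSet : Assignment → ClauseSet → Set
SatSet σ F = ∀ c → F c → SatClause σ c

data Fm : Set where
  ⊤ᶠ   : Fm
  ⊥ᶠ   : Fm
  litᶠ : Literal → Fm
  _∧ᶠ_ : Fm → Fm → Fm
  _∨ᶠ_ : Fm → Fm → Fm

evalFm : Assignment → Fm → Bool
evalFm σ ⊤ᶠ       = true
evalFm σ ⊥ᶠ       = false
evalFm σ (litᶠ l) = evalLit σ l
evalFm σ (φ ∧ᶠ ψ) = evalFm σ φ ∧ evalFm σ ψ
evalFm σ (φ ∨ᶠ ψ) = evalFm σ φ ∨ evalFm σ ψ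

_⊨_∨ᶜ_ : ClauseSet → Fm → Clause → Set
F ⊨ φ ∨ᶜ c = ∀ (σ : Assignment) → SatSet σ F → (evalFm σ φ ≡ true) ⊎ SatClause σ c

_⊨¬_∨ᶜ_ : ClauseSet → Fm → Clause → Set
G ⊨¬ φ ∨ᶜ c = ∀ (σ : Assignment) → SatSet σ G → (evalFm σ φ ≡ false) ⊎ SatClause σ c

data LitIn (l : Literal) : Fm → Set where
  here : LitIn l (litᶠ l)
  ∧ˡ : ∀ {φ ψ} → LitIn l φ → LitIn l (φ ∧ᶠ ψ)
  ∧ʳ : ∀ {φ ψ} → LitIn l ψ → LitIn l (φ ∧ᶠ ψ)
  ∨ˡ : ∀ {φ ψ} → LitIn l φ → LitIn l (φ ∨ᶠ ψ)
  ∨ʳ : ∀ {φ ψ} → LitIn l ψ → LitIn l (φ ∨ᶠ ψ)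

LitOf : ClauseSet → Literal → Set
LitOf F l = Σ Clause (λ c → F c × l ∈ c)

CoLitOf : ClauseSet → Literal → Set
CoLitOf G l = LitOf G (comp l)

-- Provenance labels: nonempty subsets of {F, G}

data Side : Set where
  sF sG : Side

data Label : Set where
  onlyF onlyG bothFG : Label

_∈ᴸ_ : Side → Label → Bool
sF ∈ᴸ onlyF  = true
sF ∈ᴸ onlyG  = false
sF ∈ᴸ bothFG = true
sG ∈ᴸ onlyF  = false
sG ∈ᴸ onlyG  = true
sG ∈ᴸ bothFG = true

_∪ᴸ_ : Label → Label → Label
onlyF ∪ᴸ onlyF = onlyF
onlyG ∪ᴸ onlyG = onlyG
_     ∪ᴸ _     = bothFG

LLit : Set
LLit = Literal × Label

LClause : Set
LClause = List LLit

restrict : Side → LClause → Clause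
restrict X [] = []
restrict X ((l , A) ∷ c) with X ∈ᴸ A
... | true  = l ∷ restrict X c
... | false = restrict X c

labelAll : Label → Clause → LClause
labelAll A = map (λ l → l , A)

data Deriv (F G : ClauseSet) : LClause → Set where
  inputF : ∀ (c : Clause) → F c → Deriv F G (labelAll onlyF c)
  inputG : ∀ (c : Clause) → G c → Deriv F G (labelAll onlyG c)
  resolve : ∀ {c₁ c₂} (C D : LClause) (L : Literal) (A B : Label) →
            Deriv F G c₁ → c₁ ↭ ((L , A) ∷ C) →
            Deriv F G c₂ → c₂ ↭ ((comp L , B) ∷ D) →
            Deriv F G (C ++ D)
  merge : ∀ {c} (C : LClause) (L : Literal) (A B : Label) →
          Deriv F G c → c ↭ ((L , A) ∷ (L , B) ∷ C) →
          Deriv F G ((L , A ∪ᴸ B) ∷ C)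

data _⊑_ {F G : ClauseSet} {c : LClause} (d : Deriv F G c) :
         ∀ {e : LClause} → Deriv F G e → Set where
  ⊑-refl : d ⊑ d
  ⊑-res₁ : ∀ {c₁ c₂ C D L A B} {d₁ : Deriv F G c₁} {p₁} {d₂ : Deriv F G c₂} {p₂} →
           d ⊑ d₁ → d ⊑ resolve C D L A B d₁ p₁ d₂ p₂
  ⊑-res₂ : ∀ {c₁ c₂ C D L A B} {d₁ : Deriv F G c₁} {p₁} {d₂ : Deriv F G c₂} {p₂} →
           d ⊑ d₂ → d ⊑ resolve C D L A B d₁ p₁ d₂ p₂
  ⊑-merge : ∀ {c' C L A B} {d' : Deriv F G c'} {p} →
            d ⊑ d' → d ⊑ merge C L A B d' p

Proof : ClauseSet → ClauseSet → Set
Proof F G = Deriv F G []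

-- ripol, as a relation (the definition allows a choice in some cases;
-- RipolRes A B L H₁ H₂ H  says H is an admissible ripol of the resolvent
-- upon L of premises labeled L^A (ripol H₁) and L̄^B (ripol H₂)).
-- The table of the paper lists the cases up to the symmetry swapping the
-- two premises (L ↔ L̄); the swapped cases are included accordingly.

data RipolRes : Label → Label → Literal → Fm → Fm → Fm → Set where
  FF    : ∀ {L H₁ H₂} → RipolRes onlyF onlyF L H₁ H₂ (H₁ ∨ᶠ H₂)
  FG₁   : ∀ {L H₁ H₂} → RipolRes onlyF onlyG L H₁ H₂ (H₁ ∨ᶠ (litᶠ L ∧ᶠ H₂))
  FG₂   : ∀ {L H₁ H₂} → RipolRes onlyF onlyG L H₁ H₂ ((litᶠ L ∨ᶠ H₁) ∧ᶠ H₂)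
  FB    : ∀ {L H₁ H₂} → RipolRes onlyF bothFG L H₁ H₂ (H₁ ∨ᶠ (litᶠ L ∧ᶠ H₂))
  GG    : ∀ {L H₁ H₂} → RipolRes onlyG onlyG L H₁ H₂ (H₁ ∧ᶠ H₂)
  GB    : ∀ {L H₁ H₂} → RipolRes onlyG bothFG L H₁ H₂ (H₁ ∧ᶠ (litᶠ (comp L) ∨ᶠ H₂))
  BB₁   : ∀ {L H₁ H₂} → RipolRes bothFG bothFG L H₁ H₂
                          ((litᶠ (comp L) ∧ᶠ H₁) ∨ᶠ (litᶠ L ∧ᶠ H₂))
  BB₂   : ∀ {L H₁ H₂} → RipolRes bothFG bothFG L H₁ H₂
                          ((litᶠ L ∨ᶠ H₁) ∧ᶠ (litᶠ (comp L) ∨ᶠ H₂))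
  GF₁   : ∀ {L H₁ H₂} → RipolRes onlyG onlyF L H₁ H₂ (H₂ ∨ᶠ (litᶠ (comp L) ∧ᶠ H₁))
  GF₂   : ∀ {L H₁ H₂} → RipolRes onlyG onlyF L H₁ H₂ ((litᶠ (comp L) ∨ᶠ H₂) ∧ᶠ H₁)
  BF    : ∀ {L H₁ H₂} → RipolRes bothFG onlyF L H₁ H₂ (H₂ ∨ᶠ (litᶠ (comp L) ∧ᶠ H₁))
  BG    : ∀ {L H₁ H₂} → RipolRes bothFG onlyG L H₁ H₂ (H₂ ∧ᶠ (litᶠ L ∨ᶠ H₁))

data Ripol {F G : ClauseSet} : ∀ {c : LClause} → Deriv F G c → Fm → Set where
  rInF : ∀ {c p} → Ripol (inputF c p) ⊥ᶠ
  rInG : ∀ {c p} → Ripol (inputG c p) ⊤ᶠ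
  rMerge : ∀ {c' C L A B} {d : Deriv F G c'} {p} {H} →
           Ripol d H → Ripol (merge C L A B d p) H
  rRes : ∀ {c₁ c₂ C D L A B} {d₁ : Deriv F G c₁} {p₁} {d₂ : Deriv F G c₂} {p₂}
           {H₁ H₂ H} →
         Ripol d₁ H₁ → Ripol d₂ H₂ → RipolRes A B L H₁ H₂ H →
         Ripol (resolve C D L A B d₁ p₁ d₂ p₂) H

-- Both parts are invariants of derivations, proved by induction.
--
-- (i) For a model σ of the input set of side X, either σ gives ripol(C) the
-- polarity of X (true for F, false for G) or σ satisfies an X-labelled literal
-- of C. At a resolution step, once the two premises are reduced to their
-- resolved literal, this becomes, for each row of the ripol table, a Boolean
-- tautology in the values of the two premise ripols and of L, checked by
-- evaluation.
--
-- (ii) Every X-labelled literal occurrence of a derived clause occurs in the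
-- input set of X. The resolved literal L enters ripol only in rows where L is
-- F-labelled and L̄ is G-labelled, and L̄ only where L̄ is F-labelled and L is
-- G-labelled; in either case the new literal lies in Lit(F) ∩ Lit‾(G).
module Submission where

open import Defs
open import Data.Bool using (Bool; true; false; not; _∧_; _∨_; T)
open import Data.Bool.Properties using (T-∧; T-≡; not-involutive; not-injective; ∨-zeroʳ)
open import Data.List using (_∷_; _++_)
open import Data.List.Membership.Propositional using (_∈_)
open import Data.List.Membership.Propositional.Properties using (∈-map⁻; ∈-++⁻)
open import Data.List.Relation.Unary.Any as Any using (Any; here; there)
open import Data.List.Relation.Unary.Any.Properties using (map⁺; ++⁺ˡ; ++⁺ʳ)
open import Data.List.Relation.Binary.Permutation.Propositional using (↭-sym)
open import Data.List.Relation.Binary.Permutation.Propositional.Properties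
  using (Any-resp-↭; ∈-resp-↭)
open import Data.Product using (_×_; _,_; proj₁; proj₂)
open import Data.Sum as Sum using (_⊎_; inj₁; inj₂)
open import Data.Unit using (⊤; tt)
open import Function using (Equivalence; _∘′_)
open import Relation.Binary.PropositionalEquality using (_≡_; refl; sym; trans; cong; subst)

comp-involutive : ∀ l → comp (comp l) ≡ l
comp-involutive (mkLit a s) = cong (mkLit a) (not-involutive s)

evalLit-comp : ∀ σ l → evalLit σ (comp l) ≡ not (evalLit σ l)
evalLit-comp σ (mkLit a true)  = refl
evalLit-comp σ (mkLit a false) = sym (not-involutive (σ a))

∈ᴸ-∪ᴸ : ∀ X A B → X ∈ᴸ (A ∪ᴸ B) ≡ X ∈ᴸ A ∨ X ∈ᴸ B
∈ᴸ-∪ᴸ sF bothFG _      = refl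
∈ᴸ-∪ᴸ sG bothFG _      = refl
∈ᴸ-∪ᴸ sF onlyF  onlyF  = refl
∈ᴸ-∪ᴸ sG onlyF  onlyF  = refl
∈ᴸ-∪ᴸ sF onlyF  onlyG  = refl
∈ᴸ-∪ᴸ sG onlyF  onlyG  = refl
∈ᴸ-∪ᴸ sF onlyF  bothFG = refl
∈ᴸ-∪ᴸ sG onlyF  bothFG = refl
∈ᴸ-∪ᴸ sF onlyG  onlyF  = refl
∈ᴸ-∪ᴸ sG onlyG  onlyF  = refl
∈ᴸ-∪ᴸ sF onlyG  onlyG  = refl
∈ᴸ-∪ᴸ sG onlyG  onlyG  = refl
∈ᴸ-∪ᴸ sF onlyG  bothFG = refl
∈ᴸ-∪ᴸ sG onlyG  bothFG = refl

∈ᴸ-∪ᴸ⁺ˡ : ∀ X A B → X ∈ᴸ A ≡ true → X ∈ᴸ (A ∪ᴸ B) ≡ true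
∈ᴸ-∪ᴸ⁺ˡ X A B e = trans (∈ᴸ-∪ᴸ X A B) (cong (_∨ X ∈ᴸ B) e)

∈ᴸ-∪ᴸ⁺ʳ : ∀ X A B → X ∈ᴸ B ≡ true → X ∈ᴸ (A ∪ᴸ B) ≡ true
∈ᴸ-∪ᴸ⁺ʳ X A B e = trans (∈ᴸ-∪ᴸ X A B) (trans (cong (X ∈ᴸ A ∨_) e) (∨-zeroʳ (X ∈ᴸ A)))

∨-true⁻ : ∀ x {y} → x ∨ y ≡ true → x ≡ true ⊎ y ≡ true
∨-true⁻ true  _ = inj₁ refl
∨-true⁻ false e = inj₂ e

∈ᴸ-∪ᴸ⁻ : ∀ X A B → X ∈ᴸ (A ∪ᴸ B) ≡ true → X ∈ᴸ A ≡ true ⊎ X ∈ᴸ B ≡ true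
∈ᴸ-∪ᴸ⁻ X A B e = ∨-true⁻ (X ∈ᴸ A) (trans (sym (∈ᴸ-∪ᴸ X A B)) e)

inputs : ClauseSet → ClauseSet → Side → ClauseSet
inputs F G sF = F
inputs F G sG = G

-- The truth value a model of the X-side inputs must give ripol, unless it satisfies C|_X.
polar : Side → Bool → Bool
polar sF b = b
polar sG b = not b

Holds : Assignment → Side → LLit → Set
Holds σ X (l , A) = X ∈ᴸ A ≡ true × evalLit σ l ≡ true

labelAll-holds : ∀ {σ X A} c → X ∈ᴸ A ≡ true → SatClause σ c → Any (Holds σ X) (labelAll A c)
labelAll-holds c e s = map⁺ (Any.map (e ,_) s)

restrict-sat : ∀ {σ} X c → Any (Holds σ X) c → SatClause σ (restrict X c)
restrict-sat X ((l , A) ∷ c) (here (e , t)) rewrite e = here t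
restrict-sat X ((l , A) ∷ c) (there s) with X ∈ᴸ A
... | true  = there (restrict-sat X c s)
... | false = restrict-sat X c s

merge-holds : ∀ {σ X C L A B} →
  Any (Holds σ X) ((L , A) ∷ (L , B) ∷ C) → Any (Holds σ X) ((L , A ∪ᴸ B) ∷ C)
merge-holds {X = X} {A = A} {B} (here (e , t))         = here (∈ᴸ-∪ᴸ⁺ˡ X A B e , t)
merge-holds {X = X} {A = A} {B} (there (here (e , t))) = here (∈ᴸ-∪ᴸ⁺ʳ X A B e , t)
merge-holds (there (there s))                          = there s

∀ᵇ : (Bool → Bool) → Bool
∀ᵇ f = f true ∧ f false

∀ᵇ-elim : ∀ {f} → T (∀ᵇ f) → ∀ b → T (f b)
∀ᵇ-elim t true  = proj₁ (Equivalence.to T-∧ t)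
∀ᵇ-elim t false = proj₂ (Equivalence.to T-∧ t)

∀ˢ : (Side → Bool) → Bool
∀ˢ f = f sF ∧ f sG

∀ˢ-elim : ∀ {f} → T (∀ˢ f) → ∀ X → T (f X)
∀ˢ-elim t sF = proj₁ (Equivalence.to T-∧ t)
∀ˢ-elim t sG = proj₂ (Equivalence.to T-∧ t)

infixr 4 _⇒ᵇ_

_⇒ᵇ_ : Bool → Bool → Bool
p ⇒ᵇ q = not p ∨ q

⇒ᵇ-elim : ∀ {p q} → T (p ⇒ᵇ q) → p ≡ true → T q
⇒ᵇ-elim t refl = t

-- What a premise C ∨ L^A provides once its side part C is known to fail.
premise : Side → Label → Bool → Bool → Bool
premise X A h ℓ = polar X h ∨ (X ∈ᴸ A ∧ ℓ)

resolutionRow : Label → Label → (Bool → Bool → Bool → Bool → Bool) →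
  Side → Bool → Bool → Bool → Bool
resolutionRow A B f X h₁ h₂ ℓ =
  premise X A h₁ ℓ ⇒ᵇ premise X B h₂ (not ℓ) ⇒ᵇ polar X (f h₁ h₂ ℓ (not ℓ))

resolutionTautology : Label → Label → (Bool → Bool → Bool → Bool → Bool) → Bool
resolutionTautology A B f = ∀ˢ λ X → ∀ᵇ λ h₁ → ∀ᵇ λ h₂ → ∀ᵇ (resolutionRow A B f X h₁ h₂)

resolutionTautology-elim : ∀ {A B} f → T (resolutionTautology A B f) →
  ∀ X h₁ h₂ ℓ → T (resolutionRow A B f X h₁ h₂ ℓ)
resolutionTautology-elim {A} {B} f taut X h₁ h₂ =
  ∀ᵇ-elim {row X h₁ h₂} (∀ᵇ-elim {∀ᵇ ∘′ row X h₁} (∀ᵇ-elim {λ h₁ → ∀ᵇ (∀ᵇ ∘′ row X h₁)}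
    (∀ˢ-elim {λ X → ∀ᵇ λ h₁ → ∀ᵇ (∀ᵇ ∘′ row X h₁)} taut X) h₁) h₂)
  where row = resolutionRow A B f

-- For a concrete connective f the implicit argument evaluates to ⊤, so instantiating
-- byTruthTable checks the whole truth table.
byTruthTable : ∀ {A B} L H₁ H₂ (f : Bool → Bool → Bool → Bool → Bool) →
  {_ : T (resolutionTautology A B f)} → ∀ X σ →
  premise X A (evalFm σ H₁) (evalLit σ L) ≡ true →
  premise X B (evalFm σ H₂) (evalLit σ (comp L)) ≡ true →
  polar X (f (evalFm σ H₁) (evalFm σ H₂) (evalLit σ L) (evalLit σ (comp L))) ≡ true
byTruthTable {A} {B} L H₁ H₂ f {taut} X σ p₁ =
  subst Conclusion (sym (evalLit-comp σ L))
    (λ p₂ → Equivalence.to T-≡ (⇒ᵇ-elim (⇒ᵇ-elim row p₁) p₂))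
  where
  h₁ = evalFm σ H₁
  h₂ = evalFm σ H₂
  ℓ  = evalLit σ L
  Conclusion : Bool → Set
  Conclusion ℓ̄ = premise X B h₂ ℓ̄ ≡ true → polar X (f h₁ h₂ ℓ ℓ̄) ≡ true
  row = resolutionTautology-elim f taut X h₁ h₂ ℓ

module _ {L : Literal} {H₁ H₂ : Fm} where

  resolvent-polar : ∀ {A B H} → RipolRes A B L H₁ H₂ H → ∀ X σ →
    premise X A (evalFm σ H₁) (evalLit σ L) ≡ true →
    premise X B (evalFm σ H₂) (evalLit σ (comp L)) ≡ true →
    polar X (evalFm σ H) ≡ true
  resolvent-polar FF  = byTruthTable L H₁ H₂ λ h₁ h₂ ℓ ℓ̄ → h₁ ∨ h₂
  resolvent-polar FG₁ = byTruthTable L H₁ H₂ λ h₁ h₂ ℓ ℓ̄ → h₁ ∨ (ℓ ∧ h₂)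
  resolvent-polar FG₂ = byTruthTable L H₁ H₂ λ h₁ h₂ ℓ ℓ̄ → (ℓ ∨ h₁) ∧ h₂
  resolvent-polar FB  = byTruthTable L H₁ H₂ λ h₁ h₂ ℓ ℓ̄ → h₁ ∨ (ℓ ∧ h₂)
  resolvent-polar GG  = byTruthTable L H₁ H₂ λ h₁ h₂ ℓ ℓ̄ → h₁ ∧ h₂
  resolvent-polar GB  = byTruthTable L H₁ H₂ λ h₁ h₂ ℓ ℓ̄ → h₁ ∧ (ℓ̄ ∨ h₂)
  resolvent-polar BB₁ = byTruthTable L H₁ H₂ λ h₁ h₂ ℓ ℓ̄ → (ℓ̄ ∧ h₁) ∨ (ℓ ∧ h₂)
  resolvent-polar BB₂ = byTruthTable L H₁ H₂ λ h₁ h₂ ℓ ℓ̄ → (ℓ ∨ h₁) ∧ (ℓ̄ ∨ h₂)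
  resolvent-polar GF₁ = byTruthTable L H₁ H₂ λ h₁ h₂ ℓ ℓ̄ → h₂ ∨ (ℓ̄ ∧ h₁)
  resolvent-polar GF₂ = byTruthTable L H₁ H₂ λ h₁ h₂ ℓ ℓ̄ → (ℓ̄ ∨ h₂) ∧ h₁
  resolvent-polar BF  = byTruthTable L H₁ H₂ λ h₁ h₂ ℓ ℓ̄ → h₂ ∨ (ℓ̄ ∧ h₁)
  resolvent-polar BG  = byTruthTable L H₁ H₂ λ h₁ h₂ ℓ ℓ̄ → h₂ ∧ (ℓ ∨ h₁)

PolarOrHolds : Assignment → Side → Fm → LClause → Set
PolarOrHolds σ X H c = polar X (evalFm σ H) ≡ true ⊎ Any (Holds σ X) c

split-resolved : ∀ {σ X H L A C} → PolarOrHolds σ X H ((L , A) ∷ C) →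
  premise X A (evalFm σ H) (evalLit σ L) ≡ true ⊎ Any (Holds σ X) C
split-resolved (inj₁ e) rewrite e = inj₁ refl
split-resolved {σ} {X} {H} (inj₂ (here (e , t))) rewrite e | t =
  inj₁ (∨-zeroʳ (polar X (evalFm σ H)))
split-resolved (inj₂ (there s)) = inj₂ s

resolvent-polarOrHolds : ∀ {σ X A B L H₁ H₂ H C D} → RipolRes A B L H₁ H₂ H →
  premise X A (evalFm σ H₁) (evalLit σ L) ≡ true ⊎ Any (Holds σ X) C →
  premise X B (evalFm σ H₂) (evalLit σ (comp L)) ≡ true ⊎ Any (Holds σ X) D →
  PolarOrHolds σ X H (C ++ D)
resolvent-polarOrHolds r (inj₂ s) _ = inj₂ (++⁺ˡ s)
resolvent-polarOrHolds {C = C} r (inj₁ _) (inj₂ s) = inj₂ (++⁺ʳ C s)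
resolvent-polarOrHolds {σ} {X} r (inj₁ p₁) (inj₁ p₂) = inj₁ (resolvent-polar r X σ p₁ p₂)

ripol-polarOrHolds : ∀ {F G c H} {d : Deriv F G c} → Ripol d H →
  ∀ X σ → SatSet σ (inputs F G X) → PolarOrHolds σ X H c
ripol-polarOrHolds {d = inputF c p} rInF sF σ σ⊨F = inj₂ (labelAll-holds c refl (σ⊨F c p))
ripol-polarOrHolds {d = inputF c p} rInF sG σ _   = inj₁ refl
ripol-polarOrHolds {d = inputG c p} rInG sF σ _   = inj₁ refl
ripol-polarOrHolds {d = inputG c p} rInG sG σ σ⊨G = inj₂ (labelAll-holds c refl (σ⊨G c p))
ripol-polarOrHolds {d = merge C L A B d p} (rMerge r) X σ σ⊨ =
  Sum.map₂ (merge-holds ∘′ Any-resp-↭ p) (ripol-polarOrHolds r X σ σ⊨)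
ripol-polarOrHolds {d = resolve C D L A B d₁ p₁ d₂ p₂} (rRes {H₁ = H₁} {H₂} r₁ r₂ r) X σ σ⊨ =
  resolvent-polarOrHolds r
    (split-resolved {H = H₁} (Sum.map₂ (Any-resp-↭ p₁) (ripol-polarOrHolds r₁ X σ σ⊨)))
    (split-resolved {H = H₂} (Sum.map₂ (Any-resp-↭ p₂) (ripol-polarOrHolds r₂ X σ σ⊨)))

ProvenanceSound : ClauseSet → ClauseSet → LClause → Set
ProvenanceSound F G c = ∀ {l A} → (l , A) ∈ c → ∀ X → X ∈ᴸ A ≡ true → LitOf (inputs F G X) l

deriv-provenanceSound : ∀ {F G c} → Deriv F G c → ProvenanceSound F G c
deriv-provenanceSound (inputF c p) m X e with ∈-map⁻ _ m
deriv-provenanceSound (inputF c p) m sF e | _ , l∈c , refl = c , p , l∈c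
deriv-provenanceSound (inputG c p) m X e with ∈-map⁻ _ m
deriv-provenanceSound (inputG c p) m sG e | _ , l∈c , refl = c , p , l∈c
deriv-provenanceSound (resolve C D L A B d₁ p₁ d₂ p₂) m with ∈-++⁻ C m
... | inj₁ m₁ = deriv-provenanceSound d₁ (∈-resp-↭ (↭-sym p₁) (there m₁))
... | inj₂ m₂ = deriv-provenanceSound d₂ (∈-resp-↭ (↭-sym p₂) (there m₂))
deriv-provenanceSound (merge C L A B d p) (here refl) X e with ∈ᴸ-∪ᴸ⁻ X A B e
... | inj₁ eA = deriv-provenanceSound d (∈-resp-↭ (↭-sym p) (here refl)) X eA
... | inj₂ eB = deriv-provenanceSound d (∈-resp-↭ (↭-sym p) (there (here refl))) X eB
deriv-provenanceSound (merge C L A B d p) (there m) =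
  deriv-provenanceSound d (∈-resp-↭ (↭-sym p) (there (there m)))

AllLits : (Literal → Set) → Fm → Set
AllLits P ⊤ᶠ       = ⊤
AllLits P ⊥ᶠ       = ⊤
AllLits P (litᶠ l) = P l
AllLits P (φ ∧ᶠ ψ) = AllLits P φ × AllLits P ψ
AllLits P (φ ∨ᶠ ψ) = AllLits P φ × AllLits P ψ

AllLits-LitIn : ∀ {P l φ} → AllLits P φ → LitIn l φ → P l
AllLits-LitIn a       here   = a
AllLits-LitIn (a , _) (∧ˡ m) = AllLits-LitIn a m
AllLits-LitIn (_ , a) (∧ʳ m) = AllLits-LitIn a m
AllLits-LitIn (a , _) (∨ˡ m) = AllLits-LitIn a m
AllLits-LitIn (_ , a) (∨ʳ m) = AllLits-LitIn a m

resolvent-allLits : ∀ {P A B L H₁ H₂ H} → RipolRes A B L H₁ H₂ H →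
  AllLits P H₁ → AllLits P H₂ →
  (sF ∈ᴸ A ≡ true → sG ∈ᴸ B ≡ true → P L) →
  (sF ∈ᴸ B ≡ true → sG ∈ᴸ A ≡ true → P (comp L)) →
  AllLits P H
resolvent-allLits FF  a₁ a₂ pL pL̄ = a₁ , a₂
resolvent-allLits FG₁ a₁ a₂ pL pL̄ = a₁ , pL refl refl , a₂
resolvent-allLits FG₂ a₁ a₂ pL pL̄ = (pL refl refl , a₁) , a₂
resolvent-allLits FB  a₁ a₂ pL pL̄ = a₁ , pL refl refl , a₂
resolvent-allLits GG  a₁ a₂ pL pL̄ = a₁ , a₂
resolvent-allLits GB  a₁ a₂ pL pL̄ = a₁ , pL̄ refl refl , a₂
resolvent-allLits BB₁ a₁ a₂ pL pL̄ = (pL̄ refl refl , a₁) , pL refl refl , a₂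
resolvent-allLits BB₂ a₁ a₂ pL pL̄ = (pL refl refl , a₁) , pL̄ refl refl , a₂
resolvent-allLits GF₁ a₁ a₂ pL pL̄ = a₂ , pL̄ refl refl , a₁
resolvent-allLits GF₂ a₁ a₂ pL pL̄ = (pL̄ refl refl , a₂) , a₁
resolvent-allLits BF  a₁ a₂ pL pL̄ = a₂ , pL̄ refl refl , a₁
resolvent-allLits BG  a₁ a₂ pL pL̄ = a₂ , pL refl refl , a₁

Interface : ClauseSet → ClauseSet → Literal → Set
Interface F G l = LitOf F l × CoLitOf G l

ripol-allLits : ∀ {F G c H} {d : Deriv F G c} → Ripol d H → AllLits (Interface F G) H
ripol-allLits rInF       = tt
ripol-allLits rInG       = tt
ripol-allLits (rMerge r) = ripol-allLits r
ripol-allLits {F} {G} (rRes {L = L} {d₁ = d₁} {p₁} {d₂} {p₂} r₁ r₂ r) =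
  resolvent-allLits r (ripol-allLits r₁) (ripol-allLits r₂)
    (λ eF eG → resolved₁ sF eF , resolved₂ sG eG)
    (λ eF eG → resolved₂ sF eF , subst (LitOf G) (sym (comp-involutive L)) (resolved₁ sG eG))
  where
  resolved₁ = deriv-provenanceSound d₁ (∈-resp-↭ (↭-sym p₁) (here refl))
  resolved₂ = deriv-provenanceSound d₂ (∈-resp-↭ (↭-sym p₂) (here refl))

-- Both invariants hold for every derivation.
mainTheorem5 : (F G : ClauseSet) (P : Proof F G) {c : LClause} (d : Deriv F G c) →
    d ⊑ P → (H : Fm) → Ripol d H →
    ((F ⊨ H ∨ᶜ restrict sF c) × (G ⊨¬ H ∨ᶜ restrict sG c))
    × (∀ (l : Literal) → LitIn l H → LitOf F l × CoLitOf G l)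
mainTheorem5 F G _ {c} d _ H r =
  ( (λ σ σ⊨F → Sum.map₂ (restrict-sat sF c) (ripol-polarOrHolds r sF σ σ⊨F))
  , (λ σ σ⊨G → Sum.map not-injective (restrict-sat sG c) (ripol-polarOrHolds r sG σ σ⊨G)) )
  , λ l → AllLits-LitIn (ripol-allLits r)
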